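{- Let $\mathbb{F}$ be a field, $\alpha,\beta,\gamma \in \mathbb{F}$, and $f = \alpha(x_1x_2 + x_3x_4) + \beta(x_1x_3 + x_2x_4) + \gamma(x_1x_4 + x_2x_3)$. Suppose C1: $\alpha\beta\gamma \neq 0$; C2: $(\alpha^2-\beta^2)(\beta^2-\gamma^2)(\gamma^2-\alpha^2) \neq 0$; C3: none of the equations $X^2 - d_i = 0$, $i \in [3]$, has a root in $\mathbb{F}$, where $d_1 = (\alpha^2-\beta^2-\gamma^2)^2 - (2\beta\gamma)^2$, $d_2 = (-\alpha^2+\beta^2-\gamma^2)^2 - (2\alpha\gamma)^2$, $d_3 = (-\alpha^2-\beta^2+\gamma^2)^2 - (2\alpha\beta)^2$. Then $f$ satisfies none of the following properties: C1': there exist $i,j \in [4]$ and $a,b \in \mathbb{F}$ such that $f|_{x_i=a,x_j=b}$ has degree at most $1$; C2': there exist $i,j \in [4]$ such that $x_i, x_j, \partial_{x_i}(f), \partial_{x_j}(f), 1$ are linearly dependent over $\mathbb{F}$; C3': $f = l_1 l_2 + l_3 l_4$ where $l_1,\ldots,l_4$ are polynomials of degree at most $1$, $l_1,l_2$ have disjoint sets of variables, and $l_3,l_4$ have disjoint sets of variables.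
   Context: For a multilinear polynomial $p$ and variable $x_i$, the partial derivative is $\partial_{x_i}(p) = p|_{x_i=1} - p|_{x_i=0}$, where $p|_{x_i=a}$ denotes $p$ with $x_i$ set to $a$. -}

module Defs where

open import Level using (_⊔_)
open import Algebra.Bundles using (CommutativeRing)
open import Data.Bool using (Bool; true; false; if_then_else_)
open import Data.Nat using (ℕ; _<_)
open import Data.Fin using (Fin; zero; suc)
open import Data.Vec using (Vec; []; _∷_; lookup; _[_]≔_; replicate; count)
import Data.Vec.Properties as VecP
import Data.Bool.Properties as BoolP
open import Data.List using (List; []; _∷_; _++_; map; foldr)
open import Data.Product using (_×_; _,_; ∃; ∃-syntax; Σ-syntax)
open import Relation.Nullary using (¬_; does)
open import Relation.Binary.PropositionalEquality using (_≡_)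
open import Relation.Unary using (Pred)

record Field (c ℓ : Level.Level) : Set (Level.suc (c ⊔ ℓ)) where
  field
    commutativeRing : CommutativeRing c ℓ
  open CommutativeRing commutativeRing public
  field
    1≉0     : ¬ (1# ≈ 0#)
    inverse : ∀ x → ¬ (x ≈ 0#) → ∃[ y ] (x * y ≈ 1#)

-- Multilinear polynomials in n variables x₀ … x_{n-1} over a field.
-- A monomial is a subset of the variables (Vec Bool n); a multilinear
-- polynomial is given by its coefficient function.

Mono : ℕ → Set
Mono n = Vec Bool n

mdeg : ∀ {n} → Mono n → ℕ
mdeg m = count (λ b → b BoolP.≟ true) m

mone : ∀ {n} → Mono n
mone = replicate _ false

mvar : ∀ {n} → Fin n → Mono n
mvar i = mone [ i ]≔ true

_≟ₘ_ : ∀ {n} (m m′ : Mono n) → Relation.Nullary.Dec (m ≡ m′)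
_≟ₘ_ = VecP.≡-dec BoolP._≟_

-- all splittings of a monomial m into disjoint parts (T , m ∖ T)
splits : ∀ {n} → Mono n → List (Mono n × Mono n)
splits []          = ([] , []) ∷ []
splits (false ∷ m) = map (λ { (t , u) → (false ∷ t , false ∷ u) }) (splits m)
splits (true ∷ m)  = map (λ { (t , u) → (true ∷ t , false ∷ u) }) (splits m)
                  ++ map (λ { (t , u) → (false ∷ t , true ∷ u) }) (splits m)

module Poly {c ℓ} (F : Field c ℓ) where
  open Field F

  MPoly : ℕ → Set c
  MPoly n = Mono n → Carrier

  infix  4 _≈ₚ_
  infixl 6 _+ₚ_ _-ₚ_
  infixl 7 _·ₚ_ _*ₚ_

  _≈ₚ_ : ∀ {n} → MPoly n → MPoly n → Set ℓ
  p ≈ₚ q = ∀ m → p m ≈ q m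

  constₚ : ∀ {n} → Carrier → MPoly n
  constₚ a m = if does (m ≟ₘ mone) then a else 0#

  0ₚ 1ₚ : ∀ {n} → MPoly n
  0ₚ = constₚ 0#
  1ₚ = constₚ 1#

  X : ∀ {n} → Fin n → MPoly n
  X i m = if does (m ≟ₘ mvar i) then 1# else 0#

  _+ₚ_ _-ₚ_ : ∀ {n} → MPoly n → MPoly n → MPoly n
  (p +ₚ q) m = p m + q m
  (p -ₚ q) m = p m - q m

  _·ₚ_ : ∀ {n} → Carrier → MPoly n → MPoly n
  (a ·ₚ p) m = a * p m

  -- product of multilinear polynomials whose monomials are combined
  -- disjointly: coefficient of m is Σ_{T ⊆ m} p(T) q(m ∖ T).  This is
  -- the ordinary polynomial product whenever p and q have disjoint sets
  -- of variables (the only case in which it is used below).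
  _*ₚ_ : ∀ {n} → MPoly n → MPoly n → MPoly n
  (p *ₚ q) m = foldr (λ { (t , u) acc → p t * q u + acc }) 0# (splits m)

  DegLE : ∀ {n} → ℕ → MPoly n → Set ℓ
  DegLE d p = ∀ m → d < mdeg m → p m ≈ 0#

  -- restriction p|_{x_i = a}: writing p = p₀ + x_i p₁ (p₀,p₁ free of x_i),
  -- p|_{x_i=a} = p₀ + a p₁.
  _∣[_≔_] : ∀ {n} → MPoly n → Fin n → Carrier → MPoly n
  (p ∣[ i ≔ a ]) m =
    if lookup m i then 0# else p (m [ i ]≔ false) + a * p (m [ i ]≔ true)

  -- partial derivative ∂_{x_i} p = p|_{x_i=1} − p|_{x_i=0}
  ∂ : ∀ {n} → Fin n → MPoly n → MPoly n
  ∂ i p = (p ∣[ i ≔ 1# ]) -ₚ (p ∣[ i ≔ 0# ])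

  Occurs : ∀ {n} → Fin n → MPoly n → Set ℓ
  Occurs i p = ∃[ m ] (lookup m i ≡ true × ¬ (p m ≈ 0#))

  DisjointVars : ∀ {n} → MPoly n → MPoly n → Set ℓ
  DisjointVars p q = ∀ i → ¬ (Occurs i p × Occurs i q)

  lincomb : ∀ {n k} → Vec Carrier k → Vec (MPoly n) k → MPoly n
  lincomb []       []       = 0ₚ
  lincomb (a ∷ as) (p ∷ ps) = (a ·ₚ p) +ₚ lincomb as ps

  LinDep : ∀ {n k} → Vec (MPoly n) k → Set (c ⊔ ℓ)
  LinDep {k = k} ps =
    ∃[ cs ] ((∃[ j ] ¬ (lookup cs j ≈ 0#)) × (lincomb cs ps ≈ₚ 0ₚ))

-- The objects of the lemma (variables x₁,…,x₄ are indices 0,…,3).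

module Lemma7Defs {c ℓ} (F : Field c ℓ) where
  open Field F using (Carrier; _≈_; _+_; _*_; _-_; -_; 0#; 1#)
  open Poly F

  x₁ x₂ x₃ x₄ : MPoly 4
  x₁ = X zero
  x₂ = X (suc zero)
  x₃ = X (suc (suc zero))
  x₄ = X (suc (suc (suc zero)))

  fpoly : Carrier → Carrier → Carrier → MPoly 4
  fpoly α β γ =
      α ·ₚ (x₁ *ₚ x₂ +ₚ x₃ *ₚ x₄)
   +ₚ β ·ₚ (x₁ *ₚ x₃ +ₚ x₂ *ₚ x₄)
   +ₚ γ ·ₚ (x₁ *ₚ x₄ +ₚ x₂ *ₚ x₃)

  sq : Carrier → Carrier
  sq x = x * x

  two : Carrier
  two = 1# + 1#

  d₁ d₂ d₃ : Carrier → Carrier → Carrier → Carrier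
  d₁ α β γ = sq (sq α - sq β - sq γ) - sq (two * β * γ)
  d₂ α β γ = sq (- sq α + sq β - sq γ) - sq (two * α * γ)
  d₃ α β γ = sq (- sq α - sq β + sq γ) - sq (two * α * β)

  NoSqrt : Carrier → Set (c ⊔ ℓ)
  NoSqrt d = ¬ (∃[ x ] (sq x - d ≈ 0#))

  C1 C2 : Carrier → Carrier → Carrier → Set ℓ
  C1 α β γ = ¬ (α * β * γ ≈ 0#)
  C2 α β γ = ¬ ((sq α - sq β) * (sq β - sq γ) * (sq γ - sq α) ≈ 0#)

  C3 : Carrier → Carrier → Carrier → Set (c ⊔ ℓ)
  C3 α β γ = NoSqrt (d₁ α β γ) × NoSqrt (d₂ α β γ) × NoSqrt (d₃ α β γ)

  C1′ : MPoly 4 → Set (c ⊔ ℓ)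
  C1′ f = ∃[ i ] ∃[ j ] (¬ (i ≡ j) ×
            ∃[ a ] ∃[ b ] DegLE 1 ((f ∣[ i ≔ a ]) ∣[ j ≔ b ]))

  C2′ : MPoly 4 → Set (c ⊔ ℓ)
  C2′ f = ∃[ i ] ∃[ j ] (¬ (i ≡ j) ×
            LinDep (X i ∷ X j ∷ ∂ i f ∷ ∂ j f ∷ 1ₚ ∷ []))

  C3′ : MPoly 4 → Set (c ⊔ ℓ)
  C3′ f = ∃[ l₁ ] ∃[ l₂ ] ∃[ l₃ ] ∃[ l₄ ]
            (DegLE 1 l₁ × DegLE 1 l₂ × DegLE 1 l₃ × DegLE 1 l₄ ×
             DisjointVars l₁ l₂ × DisjointVars l₃ l₄ ×
             (f ≈ₚ l₁ *ₚ l₂ +ₚ l₃ *ₚ l₄))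

module Submission where

-- Every condition is reduced to a statement about the
-- coefficients of f, which form the table `coefficient`: α, β, γ on the two
-- monomials of the matching {ij, kl} they multiply, and 0 elsewhere.
--   C1′: substituting constants for x_i and x_j does not change the
--        coefficient of the complementary monomial x_k x_l (f has no terms of
--        degree 3 or 4), so it would be 0, contradicting αβγ ≠ 0.
--   C2′: comparing the coefficients of 1, x_i, x_j, x_k, x_l in a relation
--        c₀x_i + c₁x_j + c₂∂_i f + c₃∂_j f + c₄ = 0 gives a linear system whose
--        2 × 2 core has determinant u² − v² for two distinct u, v ∈ {α, β, γ}.
--   C3′: if f = l₁l₂ + l₃l₄, the symmetric coefficient matrix of f equals
--        a bᵀ + b aᵀ + c dᵀ + d cᵀ = N J Nᵀ, where a, b, c, d are the linear
--        parts of the lᵢ (its diagonal vanishes because the variables are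
--        disjoint).  Its determinant d₁ is then (det N)², a square.

open import Defs
open import Level using (Level)
open import Data.Product using (_×_; _,_; proj₁; proj₂)
open import Relation.Nullary using (¬_; yes; no; does)

open import Algebra.Bundles using (CommutativeRing; RawRing)
open import Algebra.Morphism.Structures using (module RingMorphisms)
import Algebra.Morphism.RingMonomorphism as RingMonomorphism
open import Algebra.Solver.Ring.AlmostCommutativeRing
  using (fromCommutativeRing; _-Raw-AlmostCommutative⟶_)
open import Data.Bool using (true; false; T)
open import Data.Empty using (⊥-elim)
open import Data.Fin as Fin using (Fin; zero; suc; #_; punchIn; combine; remQuot)
open import Data.Maybe using (Maybe; just; nothing; is-just)
open import Data.Nat as ℕ using (ℕ; zero; suc; z≤n; s≤s)
open import Data.Vec using (Vec; []; _∷_; lookup; tabulate; _[_]≔_)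
import Data.Vec.Properties as VecP
open import Data.Vec.Relation.Binary.Pointwise.Inductive using (Pointwise; []; _∷_)
open import Function using (id; _∘_)
open import Relation.Binary.PropositionalEquality as ≡ using (_≡_; _≢_)
open import Relation.Nullary.Decidable using (False; toWitnessFalse; dec-true; dec-false)
open import Relation.Nullary.Negation using (contradiction)

module IntegerSolver {c ℓ} (R : CommutativeRing c ℓ) where
  open CommutativeRing R hiding (zero)
  open import Relation.Binary.Reasoning.Setoid setoid
  open import Algebra.Properties.Semiring.Mult.TCOptimised semiring
    using (×-homo-+; ×1-homo-*) renaming (_×_ to _·_)
  open import Algebra.Properties.AbelianGroup +-abelianGroup using (⁻¹-∙-comm; ⁻¹-anti-homo‿-)
  open import Algebra.Properties.Group +-group using (ε⁻¹≈ε)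
  open import Algebra.Properties.CommutativeSemigroup +-commutativeSemigroup using (interchange)
  open import Algebra.Properties.Ring ring using (x[y-z]≈xy-xz; [y-z]x≈yx-zx)

  -‿+-interchange : ∀ x y z w → (x + z) - (y + w) ≈ (x - y) + (z - w)
  -‿+-interchange x y z w = begin
    (x + z) + - (y + w)     ≈⟨ +-congˡ (⁻¹-∙-comm y w) ⟨
    (x + z) + (- y + - w)   ≈⟨ interchange x z (- y) (- w) ⟩
    (x - y) + (z - w)       ∎

  -‿*-expand : ∀ x y z w → (x - y) * (z - w) ≈ (x * z + y * w) - (x * w + y * z)
  -‿*-expand x y z w = begin
    (x - y) * (z - w)                       ≈⟨ [y-z]x≈yx-zx (z - w) x y ⟩
    x * (z - w) - y * (z - w)               ≈⟨ +-cong (x[y-z]≈xy-xz x z w) (-‿cong (x[y-z]≈xy-xz y z w)) ⟩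
    (x * z - x * w) - (y * z - y * w)       ≈⟨ +-congˡ (⁻¹-anti-homo‿- (y * z) (y * w)) ⟩
    (x * z - x * w) + (y * w - y * z)       ≈⟨ -‿+-interchange (x * z) (x * w) (y * w) (y * z) ⟨
    (x * z + y * w) - (x * w + y * z)       ∎

  -‿cancel : ∀ x y z w → x + w ≈ y + z → x - y ≈ z - w
  -‿cancel x y z w x+w≈y+z = begin
    x - y                   ≈⟨ +-identityʳ (x - y) ⟨
    (x - y) + 0#            ≈⟨ +-congˡ (-‿inverseʳ w) ⟨
    (x - y) + (w - w)       ≈⟨ -‿+-interchange x y w w ⟨
    (x + w) - (y + w)       ≈⟨ +-congʳ x+w≈y+z ⟩
    (y + z) - (y + w)       ≈⟨ -‿+-interchange y y z w ⟩
    (y - y) + (z - w)       ≈⟨ +-congʳ (-‿inverseʳ y) ⟩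
    0# + (z - w)            ≈⟨ +-identityˡ (z - w) ⟩
    z - w                   ∎

  -- Integer coefficients: the pair (a , b) stands for a - b.
  ℤ-coefficients : RawRing _ _
  ℤ-coefficients = record
    { Carrier = ℕ × ℕ
    ; _≈_     = _≡_
    ; _+_     = λ { (a , b) (c , d) → (a ℕ.+ c , b ℕ.+ d) }
    ; _*_     = λ { (a , b) (c , d) → (a ℕ.* c ℕ.+ b ℕ.* d , a ℕ.* d ℕ.+ b ℕ.* c) }
    ; -_      = λ { (a , b) → (b , a) }
    ; 0#      = (0 , 0)
    ; 1#      = (1 , 0)
    }

  -- The interpretation of a - b in R.  Nonnegative integers are sent to
  -- n · 1#, so 0 and 1 are interpreted exactly as 0# and 1#.
  ⟦_⟧ℤ : ℕ × ℕ → Carrier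
  ⟦ a , zero  ⟧ℤ = a · 1#
  ⟦ a , suc b ⟧ℤ = a · 1# - suc b · 1#

  ⟦⟧ℤ-difference : ∀ a b → ⟦ a , b ⟧ℤ ≈ a · 1# - b · 1#
  ⟦⟧ℤ-difference a zero    = sym (trans (+-congˡ ε⁻¹≈ε) (+-identityʳ (a · 1#)))
  ⟦⟧ℤ-difference a (suc b) = refl

  ℤ-homomorphism : ℤ-coefficients -Raw-AlmostCommutative⟶ fromCommutativeRing R
  ℤ-homomorphism = record
    { ⟦_⟧    = ⟦_⟧ℤ
    ; +-homo = +-homo
    ; *-homo = *-homo
    ; -‿homo = -‿homo
    ; 0-homo = refl
    ; 1-homo = refl
    }
    where
    +-homo : ∀ x y → ⟦ RawRing._+_ ℤ-coefficients x y ⟧ℤ ≈ ⟦ x ⟧ℤ + ⟦ y ⟧ℤ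
    +-homo (a , b) (c , d) = begin
      ⟦ a ℕ.+ c , b ℕ.+ d ⟧ℤ                          ≈⟨ ⟦⟧ℤ-difference (a ℕ.+ c) (b ℕ.+ d) ⟩
      (a ℕ.+ c) · 1# - (b ℕ.+ d) · 1#                 ≈⟨ +-cong (×-homo-+ 1# a c) (-‿cong (×-homo-+ 1# b d)) ⟩
      (a · 1# + c · 1#) - (b · 1# + d · 1#)           ≈⟨ -‿+-interchange _ _ _ _ ⟩
      (a · 1# - b · 1#) + (c · 1# - d · 1#)           ≈⟨ +-cong (⟦⟧ℤ-difference a b) (⟦⟧ℤ-difference c d) ⟨
      ⟦ a , b ⟧ℤ + ⟦ c , d ⟧ℤ                          ∎
    *-homo : ∀ x y → ⟦ RawRing._*_ ℤ-coefficients x y ⟧ℤ ≈ ⟦ x ⟧ℤ * ⟦ y ⟧ℤ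
    *-homo (a , b) (c , d) = begin
      ⟦ a ℕ.* c ℕ.+ b ℕ.* d , a ℕ.* d ℕ.+ b ℕ.* c ⟧ℤ   ≈⟨ ⟦⟧ℤ-difference (a ℕ.* c ℕ.+ b ℕ.* d) (a ℕ.* d ℕ.+ b ℕ.* c) ⟩
      (a ℕ.* c ℕ.+ b ℕ.* d) · 1# - (a ℕ.* d ℕ.+ b ℕ.* c) · 1#
        ≈⟨ +-cong (trans (×-homo-+ 1# (a ℕ.* c) (b ℕ.* d)) (+-cong (×1-homo-* a c) (×1-homo-* b d)))
                  (-‿cong (trans (×-homo-+ 1# (a ℕ.* d) (b ℕ.* c)) (+-cong (×1-homo-* a d) (×1-homo-* b c)))) ⟩
      (A * C + B * D) - (A * D + B * C)               ≈⟨ -‿*-expand A B C D ⟨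
      (A - B) * (C - D)                               ≈⟨ *-cong (⟦⟧ℤ-difference a b) (⟦⟧ℤ-difference c d) ⟨
      ⟦ a , b ⟧ℤ * ⟦ c , d ⟧ℤ                          ∎
      where A = a · 1#; B = b · 1#; C = c · 1#; D = d · 1#
    -‿homo : ∀ x → ⟦ RawRing.-_ ℤ-coefficients x ⟧ℤ ≈ - ⟦ x ⟧ℤ
    -‿homo (a , b) = begin
      ⟦ b , a ⟧ℤ            ≈⟨ ⟦⟧ℤ-difference b a ⟩
      b · 1# - a · 1#       ≈⟨ ⁻¹-anti-homo‿- (a · 1#) (b · 1#) ⟨
      - (a · 1# - b · 1#)   ≈⟨ -‿cong (⟦⟧ℤ-difference a b) ⟨
      - ⟦ a , b ⟧ℤ          ∎

  ℤ-equal? : ∀ x y → Maybe (⟦ x ⟧ℤ ≈ ⟦ y ⟧ℤ)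
  ℤ-equal? (a , b) (c , d) with a ℕ.+ d ℕ.≟ b ℕ.+ c
  ... | no  _         = nothing
  ... | yes a+d≡b+c = just (begin
    ⟦ a , b ⟧ℤ          ≈⟨ ⟦⟧ℤ-difference a b ⟩
    a · 1# - b · 1#     ≈⟨ -‿cancel _ _ _ _ sums ⟩
    c · 1# - d · 1#     ≈⟨ ⟦⟧ℤ-difference c d ⟨
    ⟦ c , d ⟧ℤ          ∎)
    where
    sums : a · 1# + d · 1# ≈ b · 1# + c · 1#
    sums = trans (sym (×-homo-+ 1# a d)) (trans (reflexive (≡.cong (_· 1#) a+d≡b+c)) (×-homo-+ 1# b c))

  open import Algebra.Solver.Ring ℤ-coefficients (fromCommutativeRing R) ℤ-homomorphism ℤ-equal? public

  by-normalisation : ∀ {n} (e₁ e₂ : Polynomial n) (ρ : Vec Carrier n) →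
                     {T (is-just (normalise e₁ ≟N normalise e₂))} → ⟦ e₁ ⟧ ρ ≈ ⟦ e₂ ⟧ ρ
  by-normalisation e₁ e₂ ρ {_} with normalise e₁ ≟N normalise e₂
  ... | just same = prove ρ e₁ e₂ (⟦ same ⟧N-cong ρ)

-- Running a division-free computation from Defs in the
-- field `tracedField k` on inputs `symbol ρ i` yields, next to its value, an
-- expression e with ⟦ e ⟧ ρ computing to that value (on concrete data).  Hence
-- an identity between two such computations follows from `by-normalisation`
-- applied to the two recorded expressions.
module SymbolicEvaluation {c ℓ} (F : Field c ℓ) where
  open Field F hiding (zero)
  open IntegerSolver commutativeRing

  -- An element of F together with an integer-polynomial expression in k
  -- variables recording how it was computed.
  Traced : ℕ → Set c
  Traced k = Polynomial k × Carrier

  tracedRawRing : ℕ → RawRing c ℓ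
  tracedRawRing k = record
    { Carrier = Traced k
    ; _≈_     = λ s t → proj₂ s ≈ proj₂ t
    ; _+_     = λ { (e , x) (e′ , y) → (e :+ e′ , x + y) }
    ; _*_     = λ { (e , x) (e′ , y) → (e :* e′ , x * y) }
    ; -_      = λ { (e , x) → (:- e , - x) }
    ; 0#      = (con (0 , 0) , 0#)
    ; 1#      = (con (1 , 0) , 1#)
    }

  -- Forgetting the expression is a ring monomorphism onto F, so the
  -- traced elements inherit the laws of F.
  forget-isRingMonomorphism : ∀ k → RingMorphisms.IsRingMonomorphism (tracedRawRing k) rawRing proj₂
  forget-isRingMonomorphism k = record
    { isRingHomomorphism = record
      { isSemiringHomomorphism = record
        { isNearSemiringHomomorphism = record
          { +-isMonoidHomomorphism = record
            { isMagmaHomomorphism = record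
              { isRelHomomorphism = record { cong = id }
              ; homo = λ _ _ → refl
              }
            ; ε-homo = refl
            }
          ; *-homo = λ _ _ → refl
          }
        ; 1#-homo = refl
        }
      ; -‿homo = λ _ → refl
      }
    ; injective = id
    }

  -- The field of traced elements.  The expression attached to an inverse
  -- is irrelevant: symbolic evaluation is only used on division-free
  -- computations.
  tracedField : ℕ → Field c ℓ
  tracedField k = record
    { commutativeRing = record
      { RawRing (tracedRawRing k)
      ; isCommutativeRing = RingMonomorphism.isCommutativeRing (forget-isRingMonomorphism k) isCommutativeRing
      }
    ; 1≉0     = 1≉0
    ; inverse = λ { (e , x) x≉0 → let (y , xy≈1) = inverse x x≉0 in (e , y) , xy≈1 }
    }

  symbol : ∀ {k} → Vec Carrier k → Fin k → Traced k
  symbol ρ i = (var i , lookup ρ i)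

¬¬-all : ∀ {p n} {P : Fin n → Set p} → (∀ i → ¬ ¬ P i) → ¬ ¬ (∀ i → P i)
¬¬-all {n = zero}  _      all = all λ ()
¬¬-all {n = suc n} ¬¬each all =
  ¬¬each zero λ p₀ → ¬¬-all (¬¬each ∘ suc) λ rest → all λ { zero → p₀ ; (suc i) → rest i }

module Determinant {c ℓ} (R : CommutativeRing c ℓ) where
  open CommutativeRing R hiding (zero)

  Matrix : ℕ → Set c
  Matrix n = Fin n → Fin n → Carrier

  alternating-sum : ∀ {n} → (Fin n → Carrier) → Carrier
  alternating-sum {zero}  f = 0#
  alternating-sum {suc n} f = f zero - alternating-sum (f ∘ suc)

  minor : ∀ {n} → Matrix (suc n) → Fin (suc n) → Matrix n
  minor M j r s = M (suc r) (punchIn j s)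

  det : ∀ {n} → Matrix n → Carrier
  det {zero}  M = 1#
  det {suc n} M = alternating-sum (λ j → M zero j * det (minor M j))

  alternating-sum-cong : ∀ {n} {f g : Fin n → Carrier} → (∀ i → f i ≈ g i) →
                         alternating-sum f ≈ alternating-sum g
  alternating-sum-cong {zero}  f≈g = refl
  alternating-sum-cong {suc n} f≈g = +-cong (f≈g zero) (-‿cong (alternating-sum-cong (f≈g ∘ suc)))

  det-cong : ∀ {n} {M N : Matrix n} → (∀ i j → M i j ≈ N i j) → det M ≈ det N
  det-cong {zero}  M≈N = refl
  det-cong {suc n} M≈N =
    alternating-sum-cong λ j → *-cong (M≈N zero j) (det-cong λ r s → M≈N (suc r) (punchIn j s))

  -- With a, b, c, d the columns of N, the symmetric matrix
  -- a bᵀ + b aᵀ + c dᵀ + d cᵀ = N J Nᵀ, where J swaps the first two and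
  -- the last two coordinates.
  polar : Matrix 4 → Matrix 4
  polar N i j = (N i (# 0) * N j (# 1) + N j (# 0) * N i (# 1))
              + (N i (# 2) * N j (# 3) + N j (# 2) * N i (# 3))

module Monomials where
  pair : ∀ {n} → Fin n → Fin n → Mono n
  pair i j = mvar j [ i ]≔ true

  lookup-mone : ∀ {n} (i : Fin n) → lookup mone i ≡ false
  lookup-mone i = VecP.lookup-replicate i false

  lookup-mvar-self : ∀ {n} (i : Fin n) → lookup (mvar i) i ≡ true
  lookup-mvar-self i = VecP.lookup∘update i mone true

  lookup-mvar-other : ∀ {n} {i k : Fin n} → k ≢ i → lookup (mvar k) i ≡ false
  lookup-mvar-other {i = i} k≢i =
    ≡.trans (VecP.lookup∘update′ (k≢i ∘ ≡.sym) mone true) (lookup-mone i)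

  mvar-injective : ∀ {n} {i k : Fin n} → mvar k ≡ mvar i → k ≡ i
  mvar-injective {i = i} {k} mvar-k≡mvar-i with k Fin.≟ i
  ... | yes k≡i = k≡i
  ... | no  k≢i = contradiction (≡.trans (≡.sym (lookup-mvar-self k))
                                  (≡.trans (≡.cong (λ m → lookup m k) mvar-k≡mvar-i)
                                           (lookup-mvar-other (k≢i ∘ ≡.sym))))
                                λ ()

  mvar≢mone : ∀ {n} {i : Fin n} → mvar i ≢ mone
  mvar≢mone {i = i} mvar-i≡mone =
    contradiction (≡.trans (≡.sym (lookup-mvar-self i))
                    (≡.trans (≡.cong (λ m → lookup m i) mvar-i≡mone) (lookup-mone i)))
                  λ ()

module Evaluation {c ℓ} (F : Field c ℓ) where
  open Field F hiding (zero)
  open Poly F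
  open Monomials
  open IntegerSolver commutativeRing
  open import Algebra.Properties.Group +-group using (x∙y⁻¹≈ε⇒x≈y)

  cancel-nonzero : ∀ {x y} → ¬ (y ≈ 0#) → x * y ≈ 0# → x ≈ 0#
  cancel-nonzero {x} {y} y≉0 xy≈0 with inverse y y≉0
  ... | (y⁻¹ , yy⁻¹≈1) = begin
    x               ≈⟨ *-identityʳ x ⟨
    x * 1#          ≈⟨ *-congˡ yy⁻¹≈1 ⟨
    x * (y * y⁻¹)   ≈⟨ *-assoc x y y⁻¹ ⟨
    (x * y) * y⁻¹   ≈⟨ *-congʳ xy≈0 ⟩
    0# * y⁻¹        ≈⟨ zeroˡ y⁻¹ ⟩
    0#              ∎
    where open import Relation.Binary.Reasoning.Setoid setoid

  zero-factorˡ : ∀ {x} y → x ≈ 0# → x * y ≈ 0#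
  zero-factorˡ y x≈0 = trans (*-congʳ x≈0) (zeroˡ y)

  zero-factorʳ : ∀ x {y} → y ≈ 0# → x * y ≈ 0#
  zero-factorʳ x y≈0 = trans (*-congˡ y≈0) (zeroʳ x)

  X-self : ∀ {n} (i : Fin n) → X i (mvar i) ≈ 1#
  X-self i rewrite dec-true (mvar i ≟ₘ mvar i) ≡.refl = refl

  X-elsewhere : ∀ {n} {i : Fin n} {m} → m ≢ mvar i → X i m ≈ 0#
  X-elsewhere {i = i} {m} m≢xᵢ rewrite dec-false (m ≟ₘ mvar i) m≢xᵢ = refl

  constant-at-one : ∀ {n} a → constₚ {n} a mone ≈ a
  constant-at-one {n} a rewrite dec-true (mone {n} ≟ₘ mone) ≡.refl = refl

  constant-elsewhere : ∀ {n} a {m : Mono n} → m ≢ mone → constₚ a m ≈ 0#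
  constant-elsewhere a {m} m≢1 rewrite dec-false (m ≟ₘ mone) m≢1 = refl

  zero-everywhere : ∀ {n} (m : Mono n) → 0ₚ m ≈ 0#
  zero-everywhere m with does (m ≟ₘ mone)
  ... | true  = refl
  ... | false = refl

  substitute-free : ∀ {n} {p : MPoly n} {i a} {m : Mono n} → lookup m i ≡ false →
                    (p ∣[ i ≔ a ]) m ≈ p m + a * p (m [ i ]≔ true)
  substitute-free {p = p} {i} {m = m} free rewrite free =
    +-congʳ (reflexive (≡.cong p (≡.trans (≡.cong (m [ i ]≔_) (≡.sym free)) (VecP.[]≔-lookup m i))))

  substitute-bound : ∀ {n} {p : MPoly n} {i a} {m : Mono n} → lookup m i ≡ true →
                     (p ∣[ i ≔ a ]) m ≈ 0#
  substitute-bound bound rewrite bound = refl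

  ∂-free : ∀ {n} {p : MPoly n} {i} {m : Mono n} → lookup m i ≡ false → ∂ i p m ≈ p (m [ i ]≔ true)
  ∂-free {p = p} {i} {m} free = begin
    (p ∣[ i ≔ 1# ]) m - (p ∣[ i ≔ 0# ]) m
      ≈⟨ +-cong (substitute-free {p = p} free) (-‿cong (substitute-free {p = p} free)) ⟩
    (p m + 1# * q) - (p m + 0# * q)
      ≈⟨ solve 2 (λ x y → (x :+ con (1 , 0) :* y) :- (x :+ con (0 , 0) :* y) := y) refl (p m) q ⟩
    q ∎
    where
    open import Relation.Binary.Reasoning.Setoid setoid
    q = p (m [ i ]≔ true)

  ∂-bound : ∀ {n} {p : MPoly n} {i} {m : Mono n} → lookup m i ≡ true → ∂ i p m ≈ 0#
  ∂-bound {p = p} bound =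
    trans (+-cong (substitute-bound {p = p} bound) (-‿cong (substitute-bound {p = p} bound))) (-‿inverseʳ 0#)

  substitute-cong : ∀ {n} {p q : MPoly n} {i a} → p ≈ₚ q → p ∣[ i ≔ a ] ≈ₚ q ∣[ i ≔ a ]
  substitute-cong {i = i} p≈q m with lookup m i
  ... | true  = refl
  ... | false = +-cong (p≈q _) (*-congˡ (p≈q _))

  ∂-cong : ∀ {n} {p q : MPoly n} {i} → p ≈ₚ q → ∂ i p ≈ₚ ∂ i q
  ∂-cong p≈q m = +-cong (substitute-cong p≈q m) (-‿cong (substitute-cong p≈q m))

  lincomb-cong : ∀ {n k} (cs : Vec Carrier k) {ps qs : Vec (MPoly n) k} →
                 Pointwise _≈ₚ_ ps qs → lincomb cs ps ≈ₚ lincomb cs qs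
  lincomb-cong []       []               m = refl
  lincomb-cong (a ∷ as) (p≈q ∷ ps≈qs) m = +-cong (*-congˡ (p≈q m)) (lincomb-cong as ps≈qs m)

  degree-cong : ∀ {n d} {p q : MPoly n} → p ≈ₚ q → DegLE d p → DegLE d q
  degree-cong p≈q deg-p m d<m = trans (sym (p≈q m)) (deg-p m d<m)

  Relation : ∀ {n} → MPoly n → Fin n → Fin n → Vec Carrier 5 → Set ℓ
  Relation p i j cs = lincomb cs (X i ∷ X j ∷ ∂ i p ∷ ∂ j p ∷ 1ₚ ∷ []) ≈ₚ 0ₚ

  record RelationEquations {n} (p : MPoly n) (i j : Fin n) (c₀ c₁ c₂ c₃ c₄ : Carrier) : Set ℓ where
    field
      at-1  : c₄ ≈ 0#
      at-xᵢ : c₀ + c₃ * p (pair j i) ≈ 0#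
      at-xⱼ : c₁ + c₂ * p (pair i j) ≈ 0#
      at-xₖ : ∀ k {k≢i : False (k Fin.≟ i)} {k≢j : False (k Fin.≟ j)} →
              c₂ * p (pair i k) + c₃ * p (pair j k) ≈ 0#

  relation-equations : ∀ {n} {p : MPoly n} {i j} {c₀ c₁ c₂ c₃ c₄} →
                       (∀ k → p (mvar k) ≈ 0#) → i ≢ j →
                       Relation p i j (c₀ ∷ c₁ ∷ c₂ ∷ c₃ ∷ c₄ ∷ []) →
                       RelationEquations p i j c₀ c₁ c₂ c₃ c₄
  relation-equations {n} {p} {i} {j} {c₀} {c₁} {c₂} {c₃} {c₄} no-linear i≢j relation = record
    { at-1  = trans (solve 5 (λ c₀ c₁ c₂ c₃ c₄ →
                        c₄ := c₀ :* 𝟘 :+ (c₁ :* 𝟘 :+ (c₂ :* 𝟘 :+ (c₃ :* 𝟘 :+ c₄ :* 𝟙)))) refl c₀ c₁ c₂ c₃ c₄)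
                    (at mone (X-elsewhere {i = i} (mvar≢mone ∘ ≡.sym)) (X-elsewhere {i = j} (mvar≢mone ∘ ≡.sym))
                        (trans (∂-free {p = p} {m = mone} (lookup-mone i)) (no-linear i))
                        (trans (∂-free {p = p} {m = mone} (lookup-mone j)) (no-linear j))
                        (constant-at-one {n} 1#))
    ; at-xᵢ = trans (solve 6 (λ c₀ c₁ c₂ c₃ c₄ r →
                        c₀ :+ c₃ :* r := c₀ :* 𝟙 :+ (c₁ :* 𝟘 :+ (c₂ :* 𝟘 :+ (c₃ :* r :+ c₄ :* 𝟘)))) refl c₀ c₁ c₂ c₃ c₄ _)
                    (at (mvar i) (X-self i) (X-elsewhere {i = j} (i≢j ∘ mvar-injective))
                        (∂-bound {p = p} {i} (lookup-mvar-self i)) (∂-free {p = p} {j} (lookup-mvar-other i≢j))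
                        (constant-elsewhere 1# {mvar i} mvar≢mone))
    ; at-xⱼ = trans (solve 6 (λ c₀ c₁ c₂ c₃ c₄ r →
                        c₁ :+ c₂ :* r := c₀ :* 𝟘 :+ (c₁ :* 𝟙 :+ (c₂ :* r :+ (c₃ :* 𝟘 :+ c₄ :* 𝟘)))) refl c₀ c₁ c₂ c₃ c₄ _)
                    (at (mvar j) (X-elsewhere {i = i} (i≢j ∘ ≡.sym ∘ mvar-injective)) (X-self j)
                        (∂-free {p = p} {i} (lookup-mvar-other (i≢j ∘ ≡.sym))) (∂-bound {p = p} {j} (lookup-mvar-self j))
                        (constant-elsewhere 1# {mvar j} mvar≢mone))
    ; at-xₖ = λ k {k≢i} {k≢j} → trans (solve 7 (λ c₀ c₁ c₂ c₃ c₄ u v →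
                        c₂ :* u :+ c₃ :* v := c₀ :* 𝟘 :+ (c₁ :* 𝟘 :+ (c₂ :* u :+ (c₃ :* v :+ c₄ :* 𝟘)))) refl c₀ c₁ c₂ c₃ c₄ _ _)
                    (at (mvar k) (X-elsewhere {i = i} (toWitnessFalse k≢i ∘ mvar-injective))
                        (X-elsewhere {i = j} (toWitnessFalse k≢j ∘ mvar-injective))
                        (∂-free {p = p} {i} (lookup-mvar-other (toWitnessFalse k≢i)))
                        (∂-free {p = p} {j} (lookup-mvar-other (toWitnessFalse k≢j)))
                        (constant-elsewhere 1# {mvar k} mvar≢mone))
    }
    where
    𝟘 𝟙 : ∀ {k} → Polynomial k
    𝟘 = con (0 , 0)
    𝟙 = con (1 , 0)
    at : ∀ m {v₀ v₁ v₂ v₃ v₄} → X i m ≈ v₀ → X j m ≈ v₁ → ∂ i p m ≈ v₂ → ∂ j p m ≈ v₃ → 1ₚ m ≈ v₄ →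
         c₀ * v₀ + (c₁ * v₁ + (c₂ * v₂ + (c₃ * v₃ + c₄ * v₄))) ≈ 0#
    at m e₀ e₁ e₂ e₃ e₄ = trans (sym (+-cong (*-congˡ e₀) (+-cong (*-congˡ e₁) (+-cong (*-congˡ e₂) (+-cong (*-congˡ e₃)
                                   (trans (+-cong (*-congˡ e₄) (zero-everywhere m)) (+-identityʳ _)))))))
                                (trans (relation m) (zero-everywhere m))

  open RelationEquations public

  summand-vanishes : ∀ {x y} → x + y ≈ 0# → y ≈ 0# → x ≈ 0#
  summand-vanishes {x} x+y≈0 y≈0 = trans (sym (trans (+-congˡ y≈0) (+-identityʳ x))) x+y≈0

  only-trivial-solution : ∀ {n} {p : MPoly n} {i j} {c₀ c₁ c₂ c₃ c₄ u v} → ¬ (u * u ≈ v * v) →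
                          RelationEquations p i j c₀ c₁ c₂ c₃ c₄ →
                          c₂ * u + c₃ * v ≈ 0# → c₂ * v + c₃ * u ≈ 0# →
                          ∀ k → lookup (c₀ ∷ c₁ ∷ c₂ ∷ c₃ ∷ c₄ ∷ []) k ≈ 0#
  only-trivial-solution {c₀ = c₀} {c₁} {c₂} {c₃} {c₄} {u} {v} u²≉v² eqs eq-k eq-l = λ where
      zero                         → c₀≈0
      (suc zero)                   → c₁≈0
      (suc (suc zero))             → c₂≈0
      (suc (suc (suc zero)))       → c₃≈0
      (suc (suc (suc (suc zero)))) → at-1 eqs
    where
    open import Relation.Binary.Reasoning.Setoid setoid

    u²-v²≉0 : ¬ (u * u - v * v ≈ 0#)
    u²-v²≉0 = u²≉v² ∘ x∙y⁻¹≈ε⇒x≈y _ _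

    -- c₂ (u² - v²) and c₃ (u² - v²) are combinations of the two equations.
    c₂≈0 : c₂ ≈ 0#
    c₂≈0 = cancel-nonzero u²-v²≉0 (begin
      c₂ * (u * u - v * v)                            ≈⟨ solve 4 (λ c₂ c₃ u v →
          c₂ :* (u :* u :- v :* v) := u :* (c₂ :* u :+ c₃ :* v) :- v :* (c₂ :* v :+ c₃ :* u)) refl c₂ c₃ u v ⟩
      u * (c₂ * u + c₃ * v) - v * (c₂ * v + c₃ * u)   ≈⟨ +-cong (*-congˡ eq-k) (-‿cong (*-congˡ eq-l)) ⟩
      u * 0# - v * 0#                                 ≈⟨ solve 2 (λ u v → u :* con (0 , 0) :- v :* con (0 , 0) := con (0 , 0)) refl u v ⟩
      0#                                              ∎)

    c₃≈0 : c₃ ≈ 0#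
    c₃≈0 = cancel-nonzero u²-v²≉0 (begin
      c₃ * (u * u - v * v)                            ≈⟨ solve 4 (λ c₂ c₃ u v →
          c₃ :* (u :* u :- v :* v) := u :* (c₂ :* v :+ c₃ :* u) :- v :* (c₂ :* u :+ c₃ :* v)) refl c₂ c₃ u v ⟩
      u * (c₂ * v + c₃ * u) - v * (c₂ * u + c₃ * v)   ≈⟨ +-cong (*-congˡ eq-l) (-‿cong (*-congˡ eq-k)) ⟩
      u * 0# - v * 0#                                 ≈⟨ solve 2 (λ u v → u :* con (0 , 0) :- v :* con (0 , 0) := con (0 , 0)) refl u v ⟩
      0#                                              ∎)

    c₀≈0 : c₀ ≈ 0#
    c₀≈0 = summand-vanishes (at-xᵢ eqs) (trans (*-congʳ c₃≈0) (zeroˡ _))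

    c₁≈0 : c₁ ≈ 0#
    c₁≈0 = summand-vanishes (at-xⱼ eqs) (trans (*-congʳ c₂≈0) (zeroˡ _))

  degree-two : 1 ℕ.< 2
  degree-two = s≤s (s≤s z≤n)

  -- At x_i x_j (i < j) the product l *ₚ l′ is the sum over the splittings
  -- (x_i x_j, 1), (x_i, x_j), (x_j, x_i), (1, x_i x_j); the two outer terms
  -- vanish when l and l′ have degree at most 1.
  outer-splittings-vanish : ∀ {n} {l l′ : MPoly n} → DegLE 1 l → DegLE 1 l′ →
                            ∀ {m s t x y} → 1 ℕ.< mdeg m → l m * s + (x + (y + (t * l′ m + 0#))) ≈ x + y
  outer-splittings-vanish deg deg′ {m} {s} {t} {x} {y} two =
    trans (+-cong (*-congʳ (deg m two)) (+-congˡ (+-congˡ (+-congʳ (*-congˡ (deg′ m two))))))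
          (solve 4 (λ s t x y → 𝟘 :* s :+ (x :+ (y :+ (t :* 𝟘 :+ 𝟘))) := x :+ y) refl s t x y)
    where 𝟘 = con (0 , 0)

  outer-splittings-vanish′ : ∀ {n} {l l′ : MPoly n} → DegLE 1 l → DegLE 1 l′ →
                             ∀ {m s t x y} → 1 ℕ.< mdeg m → l m * s + (x + (y + (t * l′ m + 0#))) ≈ y + x
  outer-splittings-vanish′ deg deg′ two = trans (outer-splittings-vanish deg deg′ two) (+-comm _ _)

  product-at-pair : ∀ {l l′ : MPoly 4} → DegLE 1 l → DegLE 1 l′ → ∀ {i j} → i ≢ j →
                    (l *ₚ l′) (pair i j) ≈ l (mvar i) * l′ (mvar j) + l (mvar j) * l′ (mvar i)
  product-at-pair deg deg′ {zero}                {zero}                i≢j = ⊥-elim (i≢j ≡.refl)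
  product-at-pair deg deg′ {zero}                {suc zero}            _   = outer-splittings-vanish deg deg′ degree-two
  product-at-pair deg deg′ {zero}                {suc (suc zero)}      _   = outer-splittings-vanish deg deg′ degree-two
  product-at-pair deg deg′ {zero}                {suc (suc (suc zero))} _  = outer-splittings-vanish deg deg′ degree-two
  product-at-pair deg deg′ {suc zero}            {zero}                _   = outer-splittings-vanish′ deg deg′ degree-two
  product-at-pair deg deg′ {suc zero}            {suc zero}            i≢j = ⊥-elim (i≢j ≡.refl)
  product-at-pair deg deg′ {suc zero}            {suc (suc zero)}      _   = outer-splittings-vanish deg deg′ degree-two
  product-at-pair deg deg′ {suc zero}            {suc (suc (suc zero))} _  = outer-splittings-vanish deg deg′ degree-two
  product-at-pair deg deg′ {suc (suc zero)}      {zero}                _   = outer-splittings-vanish′ deg deg′ degree-two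
  product-at-pair deg deg′ {suc (suc zero)}      {suc zero}            _   = outer-splittings-vanish′ deg deg′ degree-two
  product-at-pair deg deg′ {suc (suc zero)}      {suc (suc zero)}      i≢j = ⊥-elim (i≢j ≡.refl)
  product-at-pair deg deg′ {suc (suc zero)}      {suc (suc (suc zero))} _  = outer-splittings-vanish deg deg′ degree-two
  product-at-pair deg deg′ {suc (suc (suc zero))} {zero}               _   = outer-splittings-vanish′ deg deg′ degree-two
  product-at-pair deg deg′ {suc (suc (suc zero))} {suc zero}           _   = outer-splittings-vanish′ deg deg′ degree-two
  product-at-pair deg deg′ {suc (suc (suc zero))} {suc (suc zero)}     _   = outer-splittings-vanish′ deg deg′ degree-two
  product-at-pair deg deg′ {suc (suc (suc zero))} {suc (suc (suc zero))} i≢j = ⊥-elim (i≢j ≡.refl)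

  disjoint-linear-parts : ∀ {n} {l l′ : MPoly n} → DisjointVars l l′ → ∀ i →
                          ¬ ¬ (l (mvar i) * l′ (mvar i) ≈ 0#)
  disjoint-linear-parts disjoint i product≉0 = disjoint i
    ( (mvar i , lookup-mvar-self i , λ lᵢ≈0 → product≉0 (trans (*-congʳ lᵢ≈0) (zeroˡ _)))
    , (mvar i , lookup-mvar-self i , λ l′ᵢ≈0 → product≉0 (trans (*-congˡ l′ᵢ≈0) (zeroʳ _))) )

-- det (N J Nᵀ) = (det N)², since det J = 1: an identity in the sixteen entries
-- of N, checked by normalisation.
module PolarDeterminant {c ℓ} (F : Field c ℓ) where
  open Field F hiding (zero)
  open Determinant commutativeRing
  open IntegerSolver commutativeRing
  open SymbolicEvaluation F

  det-polar : ∀ (N : Matrix 4) → det (polar N) ≈ det N * det N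
  det-polar N = by-normalisation (proj₁ (Dᵗ.det (Dᵗ.polar Nᵗ))) (proj₁ (Dᵗ.det Nᵗ Tᵗ.* Dᵗ.det Nᵗ)) ρ
    where
    module Tᵗ = Field (tracedField 16)
    module Dᵗ = Determinant Tᵗ.commutativeRing
    ρ : Vec Carrier 16
    ρ = tabulate λ v → let (i , j) = remQuot 4 v in N i j
    Nᵗ : Dᵗ.Matrix 4
    Nᵗ i j = symbol ρ (combine i j)

module Coefficients {c ℓ} (F : Field c ℓ) (α β γ : Field.Carrier F) where
  open Field F hiding (zero)
  open Monomials

  coefficient : Mono 4 → Carrier
  coefficient (true  ∷ true  ∷ false ∷ false ∷ []) = α
  coefficient (false ∷ false ∷ true  ∷ true  ∷ []) = α
  coefficient (true  ∷ false ∷ true  ∷ false ∷ []) = β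
  coefficient (false ∷ true  ∷ false ∷ true  ∷ []) = β
  coefficient (true  ∷ false ∷ false ∷ true  ∷ []) = γ
  coefficient (false ∷ true  ∷ true  ∷ false ∷ []) = γ
  coefficient _                                    = 0#

  -- The symmetric matrix of the quadratic form f (up to a factor 2): zero
  -- diagonal, and the coefficient of x_i x_j in position (i, j).
  coefficient-matrix : Fin 4 → Fin 4 → Carrier
  coefficient-matrix i j = coefficient (pair i j)

module Lemma7Proof {c ℓ} (F : Field c ℓ) (α β γ : Field.Carrier F) where
  open Field F hiding (zero)
  open Poly F
  open Lemma7Defs F
  open Monomials
  open Evaluation F
  open Coefficients F α β γ
  open Determinant commutativeRing
  open PolarDeterminant F
  open IntegerSolver commutativeRing
  open SymbolicEvaluation F
  open import Algebra.Properties.Group +-group using (x≈y⇒x∙y⁻¹≈ε)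

  f : MPoly 4
  f = fpoly α β γ

  ρ : Vec Carrier 3
  ρ = α ∷ β ∷ γ ∷ []

  module Tᵗ = Field (tracedField 3)

  αᵗ βᵗ γᵗ : Tᵗ.Carrier
  αᵗ = symbol ρ (# 0)
  βᵗ = symbol ρ (# 1)
  γᵗ = symbol ρ (# 2)

  fᵗ coefficientᵗ : Mono 4 → Polynomial 3
  fᵗ m = proj₁ (Lemma7Defs.fpoly (tracedField 3) αᵗ βᵗ γᵗ m)
  coefficientᵗ m = proj₁ (Coefficients.coefficient (tracedField 3) αᵗ βᵗ γᵗ m)

  by-evaluation : ∀ m → {T (is-just (normalise (fᵗ m) ≟N normalise (coefficientᵗ m)))} →
                  ⟦ fᵗ m ⟧ ρ ≈ ⟦ coefficientᵗ m ⟧ ρ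
  by-evaluation m {agree} = by-normalisation (fᵗ m) (coefficientᵗ m) ρ {agree}

  f-coefficients : f ≈ₚ coefficient
  f-coefficients m@(false ∷ false ∷ false ∷ false ∷ []) = by-evaluation m
  f-coefficients m@(true  ∷ false ∷ false ∷ false ∷ []) = by-evaluation m
  f-coefficients m@(false ∷ true  ∷ false ∷ false ∷ []) = by-evaluation m
  f-coefficients m@(true  ∷ true  ∷ false ∷ false ∷ []) = by-evaluation m
  f-coefficients m@(false ∷ false ∷ true  ∷ false ∷ []) = by-evaluation m
  f-coefficients m@(true  ∷ false ∷ true  ∷ false ∷ []) = by-evaluation m
  f-coefficients m@(false ∷ true  ∷ true  ∷ false ∷ []) = by-evaluation m
  f-coefficients m@(true  ∷ true  ∷ true  ∷ false ∷ []) = by-evaluation m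
  f-coefficients m@(false ∷ false ∷ false ∷ true  ∷ []) = by-evaluation m
  f-coefficients m@(true  ∷ false ∷ false ∷ true  ∷ []) = by-evaluation m
  f-coefficients m@(false ∷ true  ∷ false ∷ true  ∷ []) = by-evaluation m
  f-coefficients m@(true  ∷ true  ∷ false ∷ true  ∷ []) = by-evaluation m
  f-coefficients m@(false ∷ false ∷ true  ∷ true  ∷ []) = by-evaluation m
  f-coefficients m@(true  ∷ false ∷ true  ∷ true  ∷ []) = by-evaluation m
  f-coefficients m@(false ∷ true  ∷ true  ∷ true  ∷ []) = by-evaluation m
  f-coefficients m@(true  ∷ true  ∷ true  ∷ true  ∷ []) = by-evaluation m

  no-linear-terms : ∀ k → coefficient (mvar k) ≈ 0#
  no-linear-terms zero                   = refl
  no-linear-terms (suc zero)             = refl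
  no-linear-terms (suc (suc zero))       = refl
  no-linear-terms (suc (suc (suc zero))) = refl

  det-coefficient-matrix : det coefficient-matrix ≈ d₁ α β γ
  det-coefficient-matrix =
    by-normalisation (proj₁ (Dᵗ.det (Coefficients.coefficient-matrix (tracedField 3) αᵗ βᵗ γᵗ)))
                     (proj₁ (Lemma7Defs.d₁ (tracedField 3) αᵗ βᵗ γᵗ)) ρ
    where
    module Dᵗ = Determinant Tᵗ.commutativeRing

  substituted-coefficient : ∀ {κ a b} → (κ + a * 0#) + b * (0# + a * 0#) ≈ 0# → κ ≈ 0#
  substituted-coefficient {κ} {a} {b} =
    trans (sym (solve 3 (λ κ a b → (κ :+ a :* 𝟘) :+ b :* (𝟘 :+ a :* 𝟘) := κ) refl κ a b))
    where 𝟘 = con (0 , 0)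

  α-vanishes : α ≈ 0# → α * β * γ ≈ 0#
  α-vanishes = zero-factorˡ γ ∘ zero-factorˡ β

  β-vanishes : β ≈ 0# → α * β * γ ≈ 0#
  β-vanishes = zero-factorˡ γ ∘ zero-factorʳ α

  γ-vanishes : γ ≈ 0# → α * β * γ ≈ 0#
  γ-vanishes = zero-factorʳ (α * β)

  keeps-complementary-monomial : ∀ i j → i ≢ j → ∀ {a b} →
                                 DegLE 1 ((coefficient ∣[ i ≔ a ]) ∣[ j ≔ b ]) → α * β * γ ≈ 0#
  keeps-complementary-monomial zero zero i≢j _ = ⊥-elim (i≢j ≡.refl)
  keeps-complementary-monomial zero (suc zero) _ deg =
    α-vanishes (substituted-coefficient (deg (pair (# 2) (# 3)) degree-two))
  keeps-complementary-monomial zero (suc (suc zero)) _ deg =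
    β-vanishes (substituted-coefficient (deg (pair (# 1) (# 3)) degree-two))
  keeps-complementary-monomial zero (suc (suc (suc zero))) _ deg =
    γ-vanishes (substituted-coefficient (deg (pair (# 1) (# 2)) degree-two))
  keeps-complementary-monomial (suc zero) zero _ deg =
    α-vanishes (substituted-coefficient (deg (pair (# 2) (# 3)) degree-two))
  keeps-complementary-monomial (suc zero) (suc zero) i≢j _ = ⊥-elim (i≢j ≡.refl)
  keeps-complementary-monomial (suc zero) (suc (suc zero)) _ deg =
    γ-vanishes (substituted-coefficient (deg (pair (# 0) (# 3)) degree-two))
  keeps-complementary-monomial (suc zero) (suc (suc (suc zero))) _ deg =
    β-vanishes (substituted-coefficient (deg (pair (# 0) (# 2)) degree-two))
  keeps-complementary-monomial (suc (suc zero)) zero _ deg =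
    β-vanishes (substituted-coefficient (deg (pair (# 1) (# 3)) degree-two))
  keeps-complementary-monomial (suc (suc zero)) (suc zero) _ deg =
    γ-vanishes (substituted-coefficient (deg (pair (# 0) (# 3)) degree-two))
  keeps-complementary-monomial (suc (suc zero)) (suc (suc zero)) i≢j _ = ⊥-elim (i≢j ≡.refl)
  keeps-complementary-monomial (suc (suc zero)) (suc (suc (suc zero))) _ deg =
    α-vanishes (substituted-coefficient (deg (pair (# 0) (# 1)) degree-two))
  keeps-complementary-monomial (suc (suc (suc zero))) zero _ deg =
    γ-vanishes (substituted-coefficient (deg (pair (# 1) (# 2)) degree-two))
  keeps-complementary-monomial (suc (suc (suc zero))) (suc zero) _ deg =
    β-vanishes (substituted-coefficient (deg (pair (# 0) (# 2)) degree-two))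
  keeps-complementary-monomial (suc (suc (suc zero))) (suc (suc zero)) _ deg =
    α-vanishes (substituted-coefficient (deg (pair (# 0) (# 1)) degree-two))
  keeps-complementary-monomial (suc (suc (suc zero))) (suc (suc (suc zero))) i≢j _ = ⊥-elim (i≢j ≡.refl)

  not-C1′ : C1 α β γ → ¬ C1′ f
  not-C1′ αβγ≉0 (i , j , i≢j , a , b , deg) =
    αβγ≉0 (keeps-complementary-monomial i j i≢j
             (degree-cong (substitute-cong (substitute-cong f-coefficients)) deg))

  DistinctSquares : Set ℓ
  DistinctSquares = ¬ (sq α ≈ sq β) × ¬ (sq β ≈ sq γ) × ¬ (sq γ ≈ sq α)

  distinct-squares : C2 α β γ → DistinctSquares
  distinct-squares product≉0 =
      (λ α²≈β² → product≉0 (zero-factorˡ _ (zero-factorˡ _ (x≈y⇒x∙y⁻¹≈ε α²≈β²))))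
    , (λ β²≈γ² → product≉0 (zero-factorˡ _ (zero-factorʳ _ (x≈y⇒x∙y⁻¹≈ε β²≈γ²))))
    , (λ γ²≈α² → product≉0 (zero-factorʳ _ (x≈y⇒x∙y⁻¹≈ε γ²≈α²)))

  ≉-sym : ∀ {x y} → ¬ (x ≈ y) → ¬ (y ≈ x)
  ≉-sym x≉y = x≉y ∘ sym

  -- For each pair (i, j) the remaining indices k < l supply the last two equations.
  no-relation : DistinctSquares → ∀ i j → i ≢ j → ∀ {c₀ c₁ c₂ c₃ c₄} →
                RelationEquations coefficient i j c₀ c₁ c₂ c₃ c₄ →
                ∀ k → lookup (c₀ ∷ c₁ ∷ c₂ ∷ c₃ ∷ c₄ ∷ []) k ≈ 0#
  no-relation _ zero zero i≢j _ = ⊥-elim (i≢j ≡.refl)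
  no-relation (_ , β≉γ , _) zero (suc zero) _ e =
    only-trivial-solution β≉γ e (at-xₖ e (# 2)) (at-xₖ e (# 3))
  no-relation (_ , _ , γ≉α) zero (suc (suc zero)) _ e =
    only-trivial-solution (≉-sym γ≉α) e (at-xₖ e (# 1)) (at-xₖ e (# 3))
  no-relation (α≉β , _ , _) zero (suc (suc (suc zero))) _ e =
    only-trivial-solution α≉β e (at-xₖ e (# 1)) (at-xₖ e (# 2))
  no-relation (_ , β≉γ , _) (suc zero) zero _ e =
    only-trivial-solution (≉-sym β≉γ) e (at-xₖ e (# 2)) (at-xₖ e (# 3))
  no-relation _ (suc zero) (suc zero) i≢j _ = ⊥-elim (i≢j ≡.refl)
  no-relation (α≉β , _ , _) (suc zero) (suc (suc zero)) _ e =
    only-trivial-solution α≉β e (at-xₖ e (# 0)) (at-xₖ e (# 3))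
  no-relation (_ , _ , γ≉α) (suc zero) (suc (suc (suc zero))) _ e =
    only-trivial-solution (≉-sym γ≉α) e (at-xₖ e (# 0)) (at-xₖ e (# 2))
  no-relation (_ , _ , γ≉α) (suc (suc zero)) zero _ e =
    only-trivial-solution γ≉α e (at-xₖ e (# 1)) (at-xₖ e (# 3))
  no-relation (α≉β , _ , _) (suc (suc zero)) (suc zero) _ e =
    only-trivial-solution (≉-sym α≉β) e (at-xₖ e (# 0)) (at-xₖ e (# 3))
  no-relation _ (suc (suc zero)) (suc (suc zero)) i≢j _ = ⊥-elim (i≢j ≡.refl)
  no-relation (_ , β≉γ , _) (suc (suc zero)) (suc (suc (suc zero))) _ e =
    only-trivial-solution β≉γ e (at-xₖ e (# 0)) (at-xₖ e (# 1))
  no-relation (α≉β , _ , _) (suc (suc (suc zero))) zero _ e =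
    only-trivial-solution (≉-sym α≉β) e (at-xₖ e (# 1)) (at-xₖ e (# 2))
  no-relation (_ , _ , γ≉α) (suc (suc (suc zero))) (suc zero) _ e =
    only-trivial-solution γ≉α e (at-xₖ e (# 0)) (at-xₖ e (# 2))
  no-relation (_ , β≉γ , _) (suc (suc (suc zero))) (suc (suc zero)) _ e =
    only-trivial-solution (≉-sym β≉γ) e (at-xₖ e (# 0)) (at-xₖ e (# 1))
  no-relation _ (suc (suc (suc zero))) (suc (suc (suc zero))) i≢j _ = ⊥-elim (i≢j ≡.refl)

  not-C2′ : C2 α β γ → ¬ C2′ f
  not-C2′ product≉0 (i , j , i≢j , cs@(c₀ ∷ c₁ ∷ c₂ ∷ c₃ ∷ c₄ ∷ []) , (k , cₖ≉0) , relation) =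
    cₖ≉0 (no-relation (distinct-squares product≉0) i j i≢j
            (relation-equations no-linear-terms i≢j relation-of-coefficients) k)
    where
    relation-of-coefficients : Relation coefficient i j cs
    relation-of-coefficients m = trans (sym (lincomb-cong cs same-family m)) (relation m)
      where
      same-family : Pointwise _≈ₚ_ (X i ∷ X j ∷ ∂ i f ∷ ∂ j f ∷ 1ₚ ∷ [])
                                   (X i ∷ X j ∷ ∂ i coefficient ∷ ∂ j coefficient ∷ 1ₚ ∷ [])
      same-family = (λ _ → refl) ∷ (λ _ → refl) ∷ ∂-cong f-coefficients ∷ ∂-cong f-coefficients
                  ∷ (λ _ → refl) ∷ []

  linear-coefficients : MPoly 4 → MPoly 4 → MPoly 4 → MPoly 4 → Matrix 4
  linear-coefficients l₁ l₂ l₃ l₄ i j = lookup (l₁ ∷ l₂ ∷ l₃ ∷ l₄ ∷ []) j (mvar i)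

  -- coefficient (x_i x_i) = coefficient (x_i) = 0.
  zero-diagonal : ∀ i → coefficient-matrix i i ≈ 0#
  zero-diagonal i = trans (reflexive (≡.cong coefficient (VecP.[]≔-idempotent mone i))) (no-linear-terms i)

  doubles-vanish : ∀ {x y} → x ≈ 0# → y ≈ 0# → (x + x) + (y + y) ≈ 0#
  doubles-vanish x≈0 y≈0 = trans (+-cong (twice x≈0) (twice y≈0)) (+-identityʳ 0#)
    where
    twice : ∀ {z} → z ≈ 0# → z + z ≈ 0#
    twice z≈0 = trans (+-cong z≈0 z≈0) (+-identityʳ 0#)

  not-C3′ : C3 α β γ → ¬ C3′ f
  not-C3′ (d₁-no-root , _) (l₁ , l₂ , l₃ , l₄ , deg₁ , deg₂ , deg₃ , deg₄ , disjoint₁₂ , disjoint₃₄ , f≈) =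
    ¬¬-all (disjoint-linear-parts disjoint₁₂) λ diagonal₁₂ →
    ¬¬-all (disjoint-linear-parts disjoint₃₄) λ diagonal₃₄ →
    d₁-no-root (det N , x≈y⇒x∙y⁻¹≈ε (begin
      det N * det N              ≈⟨ det-polar N ⟨
      det (polar N)              ≈⟨ det-cong (coefficient-matrix≈polar diagonal₁₂ diagonal₃₄) ⟨
      det coefficient-matrix     ≈⟨ det-coefficient-matrix ⟩
      d₁ α β γ                   ∎))
    where
    open import Relation.Binary.Reasoning.Setoid setoid
    N : Matrix 4
    N = linear-coefficients l₁ l₂ l₃ l₄

    coefficient-matrix≈polar : (∀ i → l₁ (mvar i) * l₂ (mvar i) ≈ 0#) → (∀ i → l₃ (mvar i) * l₄ (mvar i) ≈ 0#) →
                               ∀ i j → coefficient-matrix i j ≈ polar N i j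
    coefficient-matrix≈polar diagonal₁₂ diagonal₃₄ i j with i Fin.≟ j
    ... | yes ≡.refl = trans (zero-diagonal i) (sym (doubles-vanish (diagonal₁₂ i) (diagonal₃₄ i)))
    ... | no  i≢j    = trans (trans (sym (f-coefficients (pair i j))) (f≈ (pair i j)))
                             (+-cong (product-at-pair deg₁ deg₂ i≢j) (product-at-pair deg₃ deg₄ i≢j))

lemma7 : ∀ {c ℓ : Level} (F : Field c ℓ) (α β γ : Field.Carrier F) →
         Lemma7Defs.C1 F α β γ → Lemma7Defs.C2 F α β γ → Lemma7Defs.C3 F α β γ →
         ¬ Lemma7Defs.C1′ F (Lemma7Defs.fpoly F α β γ) ×
         ¬ Lemma7Defs.C2′ F (Lemma7Defs.fpoly F α β γ) ×
         ¬ Lemma7Defs.C3′ F (Lemma7Defs.fpoly F α β γ)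
lemma7 F α β γ c1 c2 c3 = not-C1′ c1 , not-C2′ c2 , not-C3′ c3
  where open Lemma7Proof F α β γ
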